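{- Let $n$ and $\delta$ be powers of two, $q=2^\delta$, and let $\ell$ be a power of two with $\ell\le n/2$. If $Y$ is chosen uniformly at random from $[q^n]$ then $\mathbb{E}[I_{Y,\ell}]\ge\ell/2$; and if $Y=K_{q,n}$ then $I_{Y,\ell}=\ell$.
   Context: $[m]=\{0,\dots,m-1\}$. For a nonnegative integer $X$, $X[i]$ is its $i$th base-$q$ digit (position $0$ least significant) and $X[i..j]$ the integer written $X[j]\cdots X[i]$ in base $q$. For $X,Y\in[q^n]$, $Z=X\times Y$. With $X'=X[t_0..t_1]$, $Y'=Y[0..(2\ell-1)]$, $Z'=Z[(t_1+1)..t_2]$ where $t_1=t_0+\ell-1$, $t_2=t_1+\ell\le n-1$: $Y'$ is retrorse if for any fixed values of $t_0$, of the base-$q$ digits of $X$ outside positions $t_0,\dots,t_1$, and of $Y[2\ell..(n-1)]$, each value of $Z'$ arises from at most four different values of $X'$. $I_{Y,\ell}=\ell$ if $Y'$ is retrorse and $I_{Y,\ell}=0$ otherwise. $K_{q,n}$ is the largest number in $[q^n]$ whose binary expansion has bit $i$ (from $i=0$ at the least significant end) equal to $1$ if and only if $i$ is a power of two. -}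

module Defs where

open import Data.Nat using (ℕ; zero; suc; _+_; _*_; _∸_; _^_; _≤_; _<_; _≤?_; _≟_; _≡ᵇ_; NonZero)
open import Data.Nat.DivMod using (_/_; _%_)
open import Data.Nat.Properties using (m^n≢0)
open import Data.Fin using (Fin; toℕ)
open import Data.Fin.Properties using (all?)
open import Data.List using (List; length; filter; upTo; map)
open import Data.Nat.ListAction using (sum)
open import Data.Bool.ListAction using (any)
open import Data.Bool using (Bool; if_then_else_)
open import Data.Product using (∃)
open import Relation.Nullary using (Dec; does)
open import Relation.Binary.PropositionalEquality using (_≡_)

IsPow2 : ℕ → Set
IsPow2 m = ∃ λ k → m ≡ 2 ^ k

-- Boolean test "m is a power of two" (exponent k ranges over k ≤ m, which suffices since 2^k > k)
isPow2ᵇ : ℕ → Bool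
isPow2ᵇ m = any (λ k → (2 ^ k) ≡ᵇ m) (upTo (suc m))

-- X[i..(i+len-1)] : the integer formed by base-q digits i, ..., i+len-1 of X
block : (q : ℕ) → .{{NonZero q}} → (i len X : ℕ) → ℕ
block q i len X = ((X / (q ^ i)) {{m^n≢0 q i}} % (q ^ len)) {{m^n≢0 q len}}

-- Z' = Z[(t1+1)..t2] for Z = X × Y, where X has digit block X' at positions t0..t1 (t1 = t0+ℓ-1),
-- low digits L (< q^t0) and high digits H (positions ≥ t1+1).
Z′ : (q : ℕ) → .{{NonZero q}} → (ℓ t0 L X′ H Y : ℕ) → ℕ
Z′ q ℓ t0 L X′ H Y = block q (t0 + ℓ) ℓ ((L + q ^ t0 * X′ + q ^ (t0 + ℓ) * H) * Y)

preimageCount : (q : ℕ) → .{{NonZero q}} → (ℓ t0 L H Y z : ℕ) → ℕ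
preimageCount q ℓ t0 L H Y z =
  length (filter (λ X′ → Z′ q ℓ t0 L X′ H Y ≟ z) (upTo (q ^ ℓ)))

-- Y' ∈ [q^(2ℓ)] is retrorse (w.r.t. q, n, ℓ): for every admissible t0 (t0 + 2ℓ - 1 ≤ n - 1),
-- every choice of the digits of X outside positions t0..t1 (L low part, H high part, X ∈ [q^n]),
-- every choice of Y[2ℓ..(n-1)] (Yh), each value z of Z' arises from at most four values of X'.
Retrorse : (q : ℕ) → .{{NonZero q}} → (n ℓ Y′ : ℕ) → Set
Retrorse q n ℓ Y′ =
  (t0 : Fin (suc (n ∸ 2 * ℓ))) →
  (L : Fin (q ^ toℕ t0)) →
  (H : Fin (q ^ (n ∸ (toℕ t0 + ℓ)))) →
  (Yh : Fin (q ^ (n ∸ 2 * ℓ))) →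
  (z : Fin (q ^ ℓ)) →
  preimageCount q ℓ (toℕ t0) (toℕ L) (toℕ H) (Y′ + q ^ (2 * ℓ) * toℕ Yh) (toℕ z) ≤ 4

retrorse? : (q : ℕ) → .{{_ : NonZero q}} → (n ℓ Y′ : ℕ) → Dec (Retrorse q n ℓ Y′)
retrorse? q n ℓ Y′ =
  all? λ t0 → all? λ L → all? λ H → all? λ Yh → all? λ z →
    preimageCount q ℓ (toℕ t0) (toℕ L) (toℕ H) (Y′ + q ^ (2 * ℓ) * toℕ Yh) (toℕ z) ≤? 4

I : (q : ℕ) → .{{_ : NonZero q}} → (n Y ℓ : ℕ) → ℕ
I q n Y ℓ = if does (retrorse? q n ℓ (block q 0 (2 * ℓ) Y)) then ℓ else 0

-- Σ_{Y ∈ [q^n]} I_{Y,ℓ}  (so E[I_{Y,ℓ}] = sumI / q^n for uniform Y)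
sumI : (q : ℕ) → .{{_ : NonZero q}} → (n ℓ : ℕ) → ℕ
sumI q n ℓ = sum (map (λ Y → I q n Y ℓ) (upTo (q ^ n)))

K : (δ n : ℕ) → ℕ
K δ n = sum (map (λ i → if isPow2ᵇ i then 2 ^ i else 0) (upTo (δ * n)))

module Submission where

-- If the digit blocks Z′ of X′ and X′ + d agree, then d·Y′ lies within q^ℓ of a
-- multiple of q^(2ℓ). Call Y′ spread when no d·Y′ with 0 < 4d < q^ℓ is that close to
-- a multiple: then the X′ in one fibre of Z′ are at least q^ℓ/4 apart, so there are
-- at most four of them and Y′ is retrorse. For a fixed multiplier d, at most 2q^ℓ
-- residues Y′ mod q^(2ℓ) put d·Y′ that close (halving the modulus, together with d
-- while d is even, preserves the count), so a union bound over d ≤ q^ℓ/4 shows that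
-- at least half of all Y′ are spread; since I_{Y,ℓ} depends only on Y mod q^(2ℓ),
-- E[I] ≥ ℓ/2. For K the low 2ℓ digits form q^ℓ + u with u < q^ℓ, because bit δℓ is
-- set and no power of two lies strictly between δℓ and 2δℓ; and every Y′ in
-- [q^ℓ, 2q^ℓ) is spread, since its small multiples stay inside [q^ℓ, q^(2ℓ) − q^ℓ].

open import Data.Bool using (true; false; T; if_then_else_)
open import Data.Fin using (toℕ)
open import Data.List using ([]; _∷_; _++_; map; length; filter; upTo)
open import Data.List.Properties using (upTo-∷ʳ; map-++)
open import Data.List.Membership.Propositional using (lose)
open import Data.List.Membership.Propositional.Properties using (∈-upTo⁺)
open import Data.List.Relation.Unary.All using (All; []; _∷_)
import Data.List.Relation.Unary.All.Properties as All
open import Data.List.Relation.Unary.AllPairs using (AllPairs; []; _∷_)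
import Data.List.Relation.Unary.AllPairs.Properties as AllPairs
open import Data.List.Relation.Unary.Any using (satisfied)
open import Data.List.Relation.Unary.Any.Properties using (any⁺; any⁻)
open import Data.Nat
  using (ℕ; zero; suc; _+_; _*_; _∸_; _^_; _≤_; _<_; z≤n; s≤s; s≤s⁻¹; NonZero; >-nonZero⁻¹; _<?_; _≤?_; _≟_)
open import Data.Nat.DivMod
open import Data.Nat.ListAction using (sum)
open import Data.Nat.ListAction.Properties using (sum-++)
open import Data.Nat.Properties
open import Algebra.Properties.CommutativeSemigroup +-commutativeSemigroup
  using (xy∙z≈xz∙y; xy∙z≈y∙xz) renaming (interchange to +-interchange)
open import Algebra.Properties.CommutativeSemigroup *-commutativeSemigroup using (x∙yz≈y∙xz)
open import Data.Nat.Tactic.RingSolver using (solve-∀)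
open import Data.Product using (_×_; _,_; ∃)
open import Data.Sum using (_⊎_; inj₁; inj₂; [_,_])
open import Function using (_∘_; id)
open import Relation.Binary.PropositionalEquality hiding ([_])
open import Relation.Nullary using (¬_; Dec; yes; no; does; contradiction)
open import Relation.Unary using (Decidable)

open import Defs

-- Iverson brackets and finite sums

𝟙 : {P : Set} → Dec P → ℕ
𝟙 (yes _) = 1
𝟙 (no _) = 0

𝟙≤1 : {P : Set} (p? : Dec P) → 𝟙 p? ≤ 1
𝟙≤1 (yes _) = ≤-refl
𝟙≤1 (no _) = z≤n

𝟙-yes : {P : Set} (p? : Dec P) → P → 𝟙 p? ≡ 1
𝟙-yes (yes _) _ = refl
𝟙-yes (no ¬p) p = contradiction p ¬p

𝟙-no : {P : Set} (p? : Dec P) → ¬ P → 𝟙 p? ≡ 0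
𝟙-no (yes p) ¬p = contradiction p ¬p
𝟙-no (no _) _ = refl

𝟙-cong : {P Q : Set} (p? : Dec P) (q? : Dec Q) → (P → Q) → (Q → P) → 𝟙 p? ≡ 𝟙 q?
𝟙-cong (yes p) q? P→Q Q→P = sym (𝟙-yes q? (P→Q p))
𝟙-cong (no ¬p) q? P→Q Q→P = sym (𝟙-no q? (λ q → ¬p (Q→P q)))

if-does≡*𝟙 : {P : Set} (p? : Dec P) (x : ℕ) → (if does p? then x else 0) ≡ x * 𝟙 p?
if-does≡*𝟙 (yes _) x = sym (*-identityʳ x)
if-does≡*𝟙 (no _) x = sym (*-zeroʳ x)

∑ : ℕ → (ℕ → ℕ) → ℕ
∑ zero f = 0
∑ (suc n) f = ∑ n f + f n

syntax ∑ n (λ i → e) = ∑[ i < n ] e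

∑-cong : ∀ n {f g : ℕ → ℕ} → (∀ {i} → i < n → f i ≡ g i) → ∑ n f ≡ ∑ n g
∑-cong zero f≗g = refl
∑-cong (suc n) f≗g = cong₂ _+_ (∑-cong n (λ i<n → f≗g (m<n⇒m<1+n i<n))) (f≗g (n<1+n n))

∑-mono-≤ : ∀ n {f g : ℕ → ℕ} → (∀ {i} → i < n → f i ≤ g i) → ∑ n f ≤ ∑ n g
∑-mono-≤ zero f≤g = z≤n
∑-mono-≤ (suc n) f≤g = +-mono-≤ (∑-mono-≤ n (λ i<n → f≤g (m<n⇒m<1+n i<n))) (f≤g (n<1+n n))

∑-const : ∀ n c → ∑[ _ < n ] c ≡ n * c
∑-const zero c = refl
∑-const (suc n) c = trans (cong (_+ c) (∑-const n c)) (+-comm (n * c) c)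

∑-distrib-+ : ∀ n (f g : ℕ → ℕ) → ∑[ i < n ] (f i + g i) ≡ ∑ n f + ∑ n g
∑-distrib-+ zero f g = refl
∑-distrib-+ (suc n) f g = trans (cong (_+ (f n + g n)) (∑-distrib-+ n f g)) (+-interchange (∑ n f) (∑ n g) (f n) (g n))

∑-distribˡ-* : ∀ n c (f : ℕ → ℕ) → ∑[ i < n ] (c * f i) ≡ c * ∑ n f
∑-distribˡ-* zero c f = sym (*-zeroʳ c)
∑-distribˡ-* (suc n) c f = trans (cong (_+ c * f n) (∑-distribˡ-* n c f)) (sym (*-distribˡ-+ c (∑ n f) (f n)))

∑-+ : ∀ m n (f : ℕ → ℕ) → ∑ (m + n) f ≡ ∑ m f + ∑[ i < n ] f (m + i)
∑-+ m zero f = trans (cong (λ k → ∑ k f) (+-identityʳ m)) (sym (+-identityʳ (∑ m f)))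
∑-+ m (suc n) f = begin
  ∑ (m + suc n) f                                  ≡⟨ cong (λ k → ∑ k f) (+-suc m n) ⟩
  ∑ (m + n) f + f (m + n)                          ≡⟨ cong (_+ f (m + n)) (∑-+ m n f) ⟩
  ∑ m f + ∑[ i < n ] f (m + i) + f (m + n)         ≡⟨ +-assoc (∑ m f) _ _ ⟩
  ∑ m f + ∑[ i < suc n ] f (m + i)                 ∎
  where open ≡-Reasoning

∑-comm : ∀ m n (f : ℕ → ℕ → ℕ) → ∑[ i < m ] ∑[ j < n ] f i j ≡ ∑[ j < n ] ∑[ i < m ] f i j
∑-comm zero n f = sym (trans (∑-const n 0) (*-zeroʳ n))
∑-comm (suc m) n f = begin
  ∑[ i < m ] ∑[ j < n ] f i j + ∑[ j < n ] f m j   ≡⟨ cong (_+ ∑[ j < n ] f m j) (∑-comm m n f) ⟩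
  ∑[ j < n ] ∑[ i < m ] f i j + ∑[ j < n ] f m j   ≡⟨ ∑-distrib-+ n (λ j → ∑[ i < m ] f i j) (f m) ⟨
  ∑[ j < n ] ∑[ i < suc m ] f i j                  ∎
  where open ≡-Reasoning

∑≡0⇒≡0 : ∀ n (f : ℕ → ℕ) → ∑ n f ≡ 0 → ∀ {i} → i < n → f i ≡ 0
∑≡0⇒≡0 (suc n) f ∑≡0 {i} i<1+n with m≤n⇒m<n∨m≡n (s≤s⁻¹ i<1+n)
... | inj₁ i<n = ∑≡0⇒≡0 n f (m+n≡0⇒m≡0 (∑ n f) ∑≡0) i<n
... | inj₂ refl = m+n≡0⇒n≡0 (∑ n f) ∑≡0

sum-map-upTo : ∀ n (f : ℕ → ℕ) → sum (map f (upTo n)) ≡ ∑ n f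
sum-map-upTo zero f = refl
sum-map-upTo (suc n) f = begin
  sum (map f (upTo (suc n)))            ≡⟨ cong (sum ∘ map f) (upTo-∷ʳ n) ⟨
  sum (map f (upTo n ++ n ∷ []))        ≡⟨ cong sum (map-++ f (upTo n) (n ∷ [])) ⟩
  sum (map f (upTo n) ++ f n ∷ [])      ≡⟨ sum-++ (map f (upTo n)) (f n ∷ []) ⟩
  sum (map f (upTo n)) + (f n + 0)      ≡⟨ cong₂ _+_ (sum-map-upTo n f) (+-identityʳ (f n)) ⟩
  ∑ n f + f n                           ∎
  where open ≡-Reasoning

∑-periodic : ∀ c M .{{_ : NonZero M}} (f : ℕ → ℕ) → ∑[ i < c * M ] f (i % M) ≡ c * ∑ M f
∑-periodic zero M f = refl
∑-periodic (suc c) M f = begin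
  ∑[ i < M + c * M ] f (i % M)                            ≡⟨ ∑-+ M (c * M) _ ⟩
  ∑[ i < M ] f (i % M) + ∑[ i < c * M ] f ((M + i) % M)   ≡⟨ cong₂ _+_ (∑-cong M (cong f ∘ m<n⇒m%n≡m))
                                                                       (∑-cong (c * M) (λ {i} _ → cong f (M+i%M i))) ⟩
  ∑ M f + ∑[ i < c * M ] f (i % M)                        ≡⟨ cong (∑ M f +_) (∑-periodic c M f) ⟩
  ∑ M f + c * ∑ M f                                       ∎
  where
  open ≡-Reasoning
  M+i%M : ∀ i → (M + i) % M ≡ i % M
  M+i%M i = trans (cong (_% M) (+-comm M i)) ([m+n]%n≡m%n i M)

∑<2^ : ∀ n (f : ℕ → ℕ) → (∀ i → f i ≤ 2 ^ i) → ∑ n f < 2 ^ n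
∑<2^ zero f f≤ = s≤s z≤n
∑<2^ (suc n) f f≤ = begin-strict
  ∑ n f + f n        <⟨ +-mono-<-≤ (∑<2^ n f f≤) (f≤ n) ⟩
  2 ^ n + 2 ^ n      ≡⟨ cong (2 ^ n +_) (+-identityʳ (2 ^ n)) ⟨
  2 ^ suc n          ∎
  where open ≤-Reasoning

-- Residues near zero

%-unique : ∀ {m n r} k .{{_ : NonZero n}} → r < n → m ≡ r + k * n → m % n ≡ r
%-unique {n = n} {r} k r<n refl = trans ([m+kn]%n≡m%n r k n) (m<n⇒m%n≡m r<n)

short-of-multiple⇒≤%+ : ∀ {M} .{{_ : NonZero M}} D e k → 0 < e → D + e ≡ k * M → M ≤ D % M + e
short-of-multiple⇒≤%+ {M} D e k 0<e D+e≡kM with M ≤? D % M + e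
... | yes M≤ = M≤
... | no M≰ = contradiction 0<e (<-irrefl (sym (m+n≡0⇒n≡0 (D % M) r+e≡0)))
  where
  r+e≡0 : D % M + e ≡ 0
  r+e≡0 = begin
    D % M + e                    ≡⟨ m<n⇒m%n≡m (≰⇒> M≰) ⟨
    (D % M + e) % M              ≡⟨ [m+kn]%n≡m%n (D % M + e) (D / M) M ⟨
    (D % M + e + D / M * M) % M  ≡⟨ cong (_% M) (xy∙z≈xz∙y (D % M) e (D / M * M)) ⟩
    (D % M + D / M * M + e) % M  ≡⟨ cong (λ x → (x + e) % M) (m≡m%n+[m/n]*n D M) ⟨
    (D + e) % M                  ≡⟨ cong (_% M) D+e≡kM ⟩
    (k * M) % M                  ≡⟨ m*n%n≡0 k M ⟩
    0                            ∎
    where open ≡-Reasoning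

-- The residue r modulo M is at cyclic distance less than w from 0.
NearZero : (M w r : ℕ) → Set
NearZero M w r = r < w ⊎ M < r + w

-- Both disjuncts are counted, so the value can be 2; this makes the halving identities below exact.
nearZeroCount : (M w r : ℕ) → ℕ
nearZeroCount M w r = 𝟙 (r <? w) + 𝟙 (M <? r + w)

nearZeroCount≤2 : ∀ M w r → nearZeroCount M w r ≤ 2
nearZeroCount≤2 M w r = +-mono-≤ (𝟙≤1 (r <? w)) (𝟙≤1 (M <? r + w))

nearZeroCount≡0⇒¬NearZero : ∀ M w r → nearZeroCount M w r ≡ 0 → ¬ NearZero M w r
nearZeroCount≡0⇒¬NearZero M w r c≡0 (inj₁ r<w) =
  1+n≢0 (trans (sym (𝟙-yes (r <? w) r<w)) (m+n≡0⇒m≡0 _ c≡0))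
nearZeroCount≡0⇒¬NearZero M w r c≡0 (inj₂ M<r+w) =
  1+n≢0 (trans (sym (𝟙-yes (M <? r + w) M<r+w)) (m+n≡0⇒n≡0 (𝟙 (r <? w)) c≡0))

near-multiple⇒NearZero : ∀ {M w} .{{_ : NonZero M}} D k → w ≤ M →
  D < k * M + w → k * M < D + w → NearZero M w (D % M)
near-multiple⇒NearZero {M} {w} D k w≤M D<kM+w kM<D+w with k * M ≤? D
... | yes kM≤D with m≤n⇒∃[o]m+o≡n kM≤D
...   | e , refl = inj₁ (subst (_< w) (sym [kM+e]%M≡e) e<w)
  where
  e<w : e < w
  e<w = +-cancelˡ-< (k * M) e w D<kM+w
  [kM+e]%M≡e : (k * M + e) % M ≡ e
  [kM+e]%M≡e = %-unique k (<-≤-trans e<w w≤M) (+-comm (k * M) e)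
near-multiple⇒NearZero {M} {w} D k w≤M D<kM+w kM<D+w | no kM≰D with m≤n⇒∃[o]m+o≡n (<⇒≤ (≰⇒> kM≰D))
...   | e , D+e≡kM = inj₂ (begin-strict
  M          ≤⟨ short-of-multiple⇒≤%+ D e k 0<e D+e≡kM ⟩
  D % M + e  <⟨ +-monoʳ-< (D % M) (+-cancelˡ-< D e w (subst (_< D + w) (sym D+e≡kM) kM<D+w)) ⟩
  D % M + w  ∎)
  where
  open ≤-Reasoning
  0<e : 0 < e
  0<e = +-cancelˡ-< D 0 e (subst₂ _<_ (sym (+-identityʳ D)) (sym D+e≡kM) (≰⇒> kM≰D))

NearZeroModSquare : (w : ℕ) .{{_ : NonZero w}} → ℕ → Set
NearZeroModSquare w D = NearZero (w * w) w (_%_ D (w * w) {{m*n≢0 w w}})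

*-≤-+⇒< : ∀ m {n o p q} → m * n ≤ o + m * p → o < m * q → n < p + q
*-≤-+⇒< m {n} {o} {p} {q} mn≤o+mp o<mq = *-cancelˡ-< m n (p + q) (begin-strict
  m * n          ≤⟨ mn≤o+mp ⟩
  o + m * p      <⟨ +-monoˡ-< (m * p) o<mq ⟩
  m * q + m * p  ≡⟨ +-comm (m * q) (m * p) ⟩
  m * p + m * q  ≡⟨ *-distribˡ-+ m p q ⟨
  m * (p + q)    ∎)
  where open ≤-Reasoning

module _ {T Q : ℕ} .{{_ : NonZero T}} .{{_ : NonZero Q}} where

  private instance
    TQ≢0 : NonZero (T * Q)
    TQ≢0 = m*n≢0 T Q
    QQ≢0 : NonZero (Q * Q)
    QQ≢0 = m*n≢0 Q Q

  digit-split : ∀ P → P ≡ P % (T * Q) + T * ((P / (T * Q)) % Q * Q + P / (T * Q) / Q * (Q * Q))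
  digit-split P = begin
    P                                             ≡⟨ m≡m%n+[m/n]*n P (T * Q) ⟩
    P % (T * Q) + P / (T * Q) * (T * Q)           ≡⟨ cong (λ x → P % (T * Q) + x * (T * Q)) (m≡m%n+[m/n]*n (P / (T * Q)) Q) ⟩
    P % (T * Q) + ((P / (T * Q)) % Q + P / (T * Q) / Q * Q) * (T * Q)
      ≡⟨ cong (P % (T * Q) +_) (regroup ((P / (T * Q)) % Q) (P / (T * Q) / Q) T Q) ⟩
    P % (T * Q) + T * ((P / (T * Q)) % Q * Q + P / (T * Q) / Q * (Q * Q)) ∎
    where
    open ≡-Reasoning
    regroup : ∀ z h T Q → (z + h * Q) * (T * Q) ≡ T * (z * Q + h * (Q * Q))
    regroup = solve-∀

  -- The two numbers have the same digit z at weight T·Q; cancelling it leaves T·D within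
  -- T·Q of a multiple of T·Q², i.e. D within Q of a multiple of Q².
  collision : ∀ P D → (P / (T * Q)) % Q ≡ ((P + T * D) / (T * Q)) % Q → NearZeroModSquare Q D
  collision P D same-digit =
    subst (NearZero (Q * Q) Q) [h₁QQ+D]%QQ≡D%QQ
      (near-multiple⇒NearZero D′ h₂ (m≤m*n Q Q)
        (*-≤-+⇒< T (subst (T * D′ ≤_) (sym balance) (m≤n+m (T * D′) (P % (T * Q)))) (m%n<n P₂ (T * Q)))
        (*-≤-+⇒< T (subst (T * (h₂ * (Q * Q)) ≤_) balance (m≤n+m _ (P₂ % (T * Q)))) (m%n<n P (T * Q))))
    where
    P₂ = P + T * D
    z = (P / (T * Q)) % Q
    h₁ = P / (T * Q) / Q
    h₂ = P₂ / (T * Q) / Q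
    D′ = h₁ * (Q * Q) + D
    [h₁QQ+D]%QQ≡D%QQ : D′ % (Q * Q) ≡ D % (Q * Q)
    [h₁QQ+D]%QQ≡D%QQ = trans (cong (_% (Q * Q)) (+-comm (h₁ * (Q * Q)) D)) ([m+kn]%n≡m%n D h₁ (Q * Q))
    balance : P₂ % (T * Q) + T * (h₂ * (Q * Q)) ≡ P % (T * Q) + T * D′
    balance = +-cancelʳ-≡ (T * (z * Q)) _ _ (begin
      P₂ % (T * Q) + T * (h₂ * (Q * Q)) + T * (z * Q)  ≡⟨ expand-digit (P₂ % (T * Q)) T z Q h₂ ⟩
      P₂ % (T * Q) + T * (z * Q + h₂ * (Q * Q))
        ≡⟨ cong (λ x → P₂ % (T * Q) + T * (x * Q + h₂ * (Q * Q))) same-digit ⟩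
      P₂ % (T * Q) + T * ((P₂ / (T * Q)) % Q * Q + h₂ * (Q * Q)) ≡⟨ digit-split P₂ ⟨
      P + T * D                                         ≡⟨ cong (_+ T * D) (digit-split P) ⟩
      P % (T * Q) + T * (z * Q + h₁ * (Q * Q)) + T * D ≡⟨ merge (P % (T * Q)) T z Q h₁ D ⟩
      P % (T * Q) + T * D′ + T * (z * Q)               ∎)
      where
      open ≡-Reasoning
      expand-digit : ∀ r T z Q h → r + T * (h * (Q * Q)) + T * (z * Q) ≡ r + T * (z * Q + h * (Q * Q))
      expand-digit = solve-∀
      merge : ∀ r T z Q h D → r + T * (z * Q + h * (Q * Q)) + T * D ≡ r + T * (h * (Q * Q) + D) + T * (z * Q)
      merge = solve-∀

-- A sufficient condition for retrorse

module _ {P : ℕ → Set} {Q k : ℕ} .{{_ : NonZero k}}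
         (gap : ∀ {x y} → x < y → P x → P y → Q ≤ k * (y ∸ x)) where

  private
    spaced : ∀ x xs → AllPairs _<_ (x ∷ xs) → All P (x ∷ xs) → All (_< Q) (x ∷ xs) →
      Q * length xs + k * x < k * Q
    spaced x [] _ _ (x<Q ∷ []) = subst (_< k * Q) (cong (_+ k * x) (sym (*-zeroʳ Q))) (*-monoʳ-< k x<Q)
    spaced x (y ∷ ys) ((x<y ∷ _) ∷ increasing) (Px ∷ Pys@(Py ∷ _)) (_ ∷ ys<Q) = begin-strict
      Q * suc (length ys) + k * x      ≡⟨ cong (_+ k * x) (*-suc Q (length ys)) ⟩
      Q + Q * length ys + k * x        ≤⟨ +-monoˡ-≤ (k * x) (+-monoˡ-≤ (Q * length ys) (gap x<y Px Py)) ⟩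
      k * (y ∸ x) + Q * length ys + k * x ≡⟨ xy∙z≈y∙xz (k * (y ∸ x)) (Q * length ys) (k * x) ⟩
      Q * length ys + (k * (y ∸ x) + k * x) ≡⟨ cong (Q * length ys +_) (*-distribˡ-+ k (y ∸ x) x) ⟨
      Q * length ys + k * (y ∸ x + x)  ≡⟨ cong (λ v → Q * length ys + k * v) (m∸n+n≡m (<⇒≤ x<y)) ⟩
      Q * length ys + k * y            <⟨ spaced y ys increasing Pys ys<Q ⟩
      k * Q                            ∎
      where open ≤-Reasoning

  filter-upTo-length≤ : (P? : Decidable P) → length (filter P? (upTo Q)) ≤ k
  filter-upTo-length≤ P? = bound (filter P? (upTo Q))
    (AllPairs.filter⁺ P? (AllPairs.applyUpTo⁺₁ id Q (λ i<j _ → i<j)))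
    (All.all-filter P? (upTo Q))
    (All.filter⁺ P? (All.all-upTo Q))
    where
    bound : ∀ xs → AllPairs _<_ xs → All P xs → All (_< Q) xs → length xs ≤ k
    bound [] _ _ _ = z≤n
    bound (x ∷ xs) increasing Pxs xs<Q = *-cancelˡ-< Q (length xs) k (begin-strict
      Q * length xs             ≤⟨ m≤m+n (Q * length xs) (k * x) ⟩
      Q * length xs + k * x     <⟨ spaced x xs increasing Pxs xs<Q ⟩
      k * Q                     ≡⟨ *-comm k Q ⟩
      Q * k                     ∎)
      where open ≤-Reasoning

Spread : (w : ℕ) .{{_ : NonZero w}} → ℕ → Set
Spread w Y = ∀ d → 0 < d → 4 * d < w → ¬ NearZeroModSquare w (d * Y)

^-double : ∀ q ℓ → q ^ (2 * ℓ) ≡ q ^ ℓ * q ^ ℓ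
^-double q ℓ = trans (cong (q ^_) (cong (ℓ +_) (+-identityʳ ℓ))) (^-distribˡ-+-* q ℓ ℓ)

block-collision : ∀ q .{{_ : NonZero q}} t ℓ P D → block q (t + ℓ) ℓ P ≡ block q (t + ℓ) ℓ (P + q ^ t * D) →
  NearZeroModSquare (q ^ ℓ) {{m^n≢0 q ℓ}} D
block-collision q t ℓ P D same-block =
  collision {T = q ^ t} P D (trans (cong (_% q ^ ℓ) (/-congʳ (sym tℓ))) (trans same-block (cong (_% q ^ ℓ) (/-congʳ tℓ))))
  where
  instance
    _ = m^n≢0 q t
    _ = m^n≢0 q ℓ
    _ = m^n≢0 q (t + ℓ)
    _ = m*n≢0 (q ^ t) (q ^ ℓ)
  tℓ : q ^ (t + ℓ) ≡ q ^ t * q ^ ℓ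
  tℓ = ^-distribˡ-+-* q t ℓ

spread⇒retrorse : ∀ q .{{_ : NonZero q}} n ℓ Y′ → Spread (q ^ ℓ) {{m^n≢0 q ℓ}} Y′ → Retrorse q n ℓ Y′
spread⇒retrorse q n ℓ Y′ spread t₀ L H Yh z =
  filter-upTo-length≤ gap (λ x → Z′ q ℓ t (toℕ L) x (toℕ H) Y ≟ toℕ z)
  where
  instance
    _ = m^n≢0 q ℓ
    _ = m*n≢0 (q ^ ℓ) (q ^ ℓ)
  t = toℕ t₀
  Y = Y′ + q ^ (2 * ℓ) * toℕ Yh
  Z : ℕ → ℕ
  Z x = Z′ q ℓ t (toℕ L) x (toℕ H) Y
  gap : ∀ {x y} → x < y → Z x ≡ toℕ z → Z y ≡ toℕ z → q ^ ℓ ≤ 4 * (y ∸ x)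
  gap {x} {y} x<y Zx≡z Zy≡z = ≮⇒≥ λ 4d<Q →
    spread d (m<n⇒0<n∸m x<y) 4d<Q (subst (NearZero (q ^ ℓ * q ^ ℓ) (q ^ ℓ)) dY%≡dY′% near)
    where
    d = y ∸ x
    P = (toℕ L + q ^ t * x + q ^ (t + ℓ) * toℕ H) * Y
    shift : (toℕ L + q ^ t * y + q ^ (t + ℓ) * toℕ H) * Y ≡ P + q ^ t * (d * Y)
    shift = trans (cong (λ v → (toℕ L + q ^ t * v + q ^ (t + ℓ) * toℕ H) * Y) (sym (m+[n∸m]≡n (<⇒≤ x<y))))
                  (expand (toℕ L) (q ^ t) x d (q ^ (t + ℓ)) (toℕ H) Y)
      where
      expand : ∀ L T x d B H Y → (L + T * (x + d) + B * H) * Y ≡ (L + T * x + B * H) * Y + T * (d * Y)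
      expand = solve-∀
    near : NearZeroModSquare (q ^ ℓ) (d * Y)
    near = block-collision q t ℓ P (d * Y) (trans Zx≡z (trans (sym Zy≡z) (cong (block q (t + ℓ) ℓ) shift)))
    dY%≡dY′% : (d * Y) % (q ^ ℓ * q ^ ℓ) ≡ (d * Y′) % (q ^ ℓ * q ^ ℓ)
    dY%≡dY′% = trans (cong (_% (q ^ ℓ * q ^ ℓ)) dY≡) ([m+kn]%n≡m%n (d * Y′) (d * toℕ Yh) (q ^ ℓ * q ^ ℓ))
      where
      dY≡ : d * Y ≡ d * Y′ + d * toℕ Yh * (q ^ ℓ * q ^ ℓ)
      dY≡ = trans (cong (λ M → d * (Y′ + M * toℕ Yh)) (^-double q ℓ)) (distribute d Y′ (q ^ ℓ * q ^ ℓ) (toℕ Yh))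
        where
        distribute : ∀ d Y M c → d * (Y + M * c) ≡ d * Y + d * c * M
        distribute = solve-∀

-- Counting near-zero multiples modulo powers of two

data EvenOdd : ℕ → Set where
  even : ∀ e → EvenOdd (e * 2)
  odd  : ∀ e → EvenOdd (1 + e * 2)

evenOdd : ∀ d → EvenOdd d
evenOdd zero = even 0
evenOdd (suc zero) = odd 0
evenOdd (suc (suc d)) with evenOdd d
... | even e = even (suc e)
... | odd e = odd (suc e)

∑-double : ∀ M (f : ℕ → ℕ) → ∑ (2 * M) f ≡ ∑[ i < M ] (f i + f (M + i))
∑-double M f = begin
  ∑ (M + (M + 0)) f                  ≡⟨ cong (λ n → ∑ (M + n) f) (+-identityʳ M) ⟩
  ∑ (M + M) f                        ≡⟨ ∑-+ M M f ⟩
  ∑ M f + ∑[ i < M ] f (M + i)       ≡⟨ ∑-distrib-+ M f (λ i → f (M + i)) ⟨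
  ∑[ i < M ] (f i + f (M + i))       ∎
  where open ≡-Reasoning

2*m≡m+m : ∀ m → 2 * m ≡ m + m
2*m≡m+m m = cong (m +_) (+-identityʳ m)

nearZeroCount-double : ∀ M w r → nearZeroCount (2 * M) (2 * w) (2 * r) ≡ nearZeroCount M w r
nearZeroCount-double M w r = cong₂ _+_
  (𝟙-cong (2 * r <? 2 * w) (r <? w) (*-cancelˡ-< 2 r w) (*-monoʳ-< 2))
  (𝟙-cong (2 * M <? 2 * r + 2 * w) (M <? r + w)
    (λ lt → *-cancelˡ-< 2 M (r + w) (subst (2 * M <_) (sym (*-distribˡ-+ 2 r w)) lt))
    (λ lt → subst (2 * M <_) (*-distribˡ-+ 2 r w) (*-monoʳ-< 2 lt)))

nearZeroCount-halves : ∀ {M w s} → s < M → w ≤ M →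
  nearZeroCount (2 * M) w s + nearZeroCount (2 * M) w (M + s) ≡ nearZeroCount M w s
nearZeroCount-halves {M} {w} {s} s<M w≤M = begin
  (𝟙 (s <? w) + 𝟙 (2 * M <? s + w)) + (𝟙 (M + s <? w) + 𝟙 (2 * M <? M + s + w))
    ≡⟨ cong₂ (λ x y → (𝟙 (s <? w) + x) + (y + 𝟙 (2 * M <? M + s + w)))
             (𝟙-no (2 * M <? s + w) (<⇒≯ s+w<2M)) (𝟙-no (M + s <? w) (≤⇒≯ (≤-trans w≤M (m≤m+n M s)))) ⟩
  (𝟙 (s <? w) + 0) + 𝟙 (2 * M <? M + s + w)
    ≡⟨ cong₂ _+_ (+-identityʳ _) (𝟙-cong (2 * M <? M + s + w) (M <? s + w) cancel-M add-M) ⟩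
  𝟙 (s <? w) + 𝟙 (M <? s + w) ∎
  where
  open ≡-Reasoning
  s+w<2M : s + w < 2 * M
  s+w<2M = subst (s + w <_) (sym (2*m≡m+m M)) (+-mono-<-≤ s<M w≤M)
  cancel-M : 2 * M < M + s + w → M < s + w
  cancel-M lt = +-cancelˡ-< M M (s + w) (subst₂ _<_ (2*m≡m+m M) (+-assoc M s w) lt)
  add-M : M < s + w → 2 * M < M + s + w
  add-M lt = subst₂ _<_ (sym (2*m≡m+m M)) (sym (+-assoc M s w)) (+-monoʳ-< M lt)

nearZeroMultiples : (M : ℕ) .{{_ : NonZero M}} (w d : ℕ) → ℕ
nearZeroMultiples M w d = ∑[ Y < M ] nearZeroCount M w ((d * Y) % M)

module _ {M : ℕ} .{{_ : NonZero M}} where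

  private
    instance
      2M≢0 : NonZero (2 * M)
      2M≢0 = m*n≢0 2 M

    low<2M : ∀ {s} → s < M → s < 2 * M
    low<2M s<M = <-≤-trans s<M (m≤n*m M 2)
    high<2M : ∀ {s} → s < M → M + s < 2 * M
    high<2M {s} s<M = subst (M + s <_) (sym (2*m≡m+m M)) (+-monoʳ-< M s<M)

  %-double : ∀ x → (2 * x) % (2 * M) ≡ 2 * (x % M)
  %-double x = %-unique (x / M) (*-monoʳ-< 2 (m%n<n x M)) (begin
    2 * x                        ≡⟨ cong (2 *_) (m≡m%n+[m/n]*n x M) ⟩
    2 * (x % M + x / M * M)      ≡⟨ regroup (x % M) (x / M) M ⟩
    2 * (x % M) + x / M * (2 * M) ∎)
    where
    open ≡-Reasoning
    regroup : ∀ r k M → 2 * (r + k * M) ≡ 2 * r + k * (2 * M)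
    regroup = solve-∀

  %-halves : ∀ x → (x % (2 * M) ≡ x % M × (x + M) % (2 * M) ≡ M + x % M)
                 ⊎ (x % (2 * M) ≡ M + x % M × (x + M) % (2 * M) ≡ x % M)
  %-halves x with x / M | m≡m%n+[m/n]*n x M
  ... | k | x≡s+kM with evenOdd k
  ...   | even j = inj₁ (%-unique j (low<2M (m%n<n x M)) (trans x≡s+kM (even-low (x % M) j M)) ,
                         %-unique j (high<2M (m%n<n x M)) (trans (cong (_+ M) x≡s+kM) (even-high (x % M) j M)))
    where
    even-low : ∀ s j M → s + j * 2 * M ≡ s + j * (2 * M)
    even-low = solve-∀
    even-high : ∀ s j M → s + j * 2 * M + M ≡ M + s + j * (2 * M)
    even-high = solve-∀
  ...   | odd j = inj₂ (%-unique j (high<2M (m%n<n x M)) (trans x≡s+kM (odd-low (x % M) j M)) ,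
                        %-unique (1 + j) (low<2M (m%n<n x M)) (trans (cong (_+ M) x≡s+kM) (odd-high (x % M) j M)))
    where
    odd-low : ∀ s j M → s + (1 + j * 2) * M ≡ M + s + j * (2 * M)
    odd-low = solve-∀
    odd-high : ∀ s j M → s + (1 + j * 2) * M + M ≡ s + (1 + j) * (2 * M)
    odd-high = solve-∀

  nearZeroCount-pair : ∀ {w} x → w ≤ M →
    nearZeroCount (2 * M) w (x % (2 * M)) + nearZeroCount (2 * M) w ((x + M) % (2 * M)) ≡ nearZeroCount M w (x % M)
  nearZeroCount-pair {w} x w≤M with %-halves x
  ... | inj₁ (low , high) =
    trans (cong₂ (λ r r′ → F r + F r′) low high) (nearZeroCount-halves (m%n<n x M) w≤M)
    where F = nearZeroCount (2 * M) w
  ... | inj₂ (high , low) =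
    trans (cong₂ (λ r r′ → F r + F r′) high low) (trans (+-comm (F (M + x % M)) _) (nearZeroCount-halves (m%n<n x M) w≤M))
    where F = nearZeroCount (2 * M) w

  %-odd-shift : ∀ e Y → ((1 + e * 2) * (M + Y)) % (2 * M) ≡ ((1 + e * 2) * Y + M) % (2 * M)
  %-odd-shift e Y = trans (cong (_% (2 * M)) (shift e M Y)) ([m+kn]%n≡m%n ((1 + e * 2) * Y + M) e (2 * M))
    where
    shift : ∀ e M Y → (1 + e * 2) * (M + Y) ≡ (1 + e * 2) * Y + M + e * (2 * M)
    shift = solve-∀

  nearZeroCount-even : ∀ {w} e Y → nearZeroCount (2 * M) (2 * w) ((e * 2 * Y) % (2 * M)) ≡ nearZeroCount M w ((e * Y) % M)
  nearZeroCount-even {w} e Y = begin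
    nearZeroCount (2 * M) (2 * w) ((e * 2 * Y) % (2 * M))
      ≡⟨ cong (λ x → nearZeroCount (2 * M) (2 * w) (x % (2 * M))) (e2Y≡2eY e Y) ⟩
    nearZeroCount (2 * M) (2 * w) ((2 * (e * Y)) % (2 * M)) ≡⟨ cong (nearZeroCount (2 * M) (2 * w)) (%-double (e * Y)) ⟩
    nearZeroCount (2 * M) (2 * w) (2 * ((e * Y) % M))       ≡⟨ nearZeroCount-double M w ((e * Y) % M) ⟩
    nearZeroCount M w ((e * Y) % M)                          ∎
    where
    open ≡-Reasoning
    e2Y≡2eY : ∀ e Y → e * 2 * Y ≡ 2 * (e * Y)
    e2Y≡2eY = solve-∀

  %-even-shift : ∀ e Y → (e * 2 * (M + Y)) % (2 * M) ≡ (e * 2 * Y) % (2 * M)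
  %-even-shift e Y = trans (cong (_% (2 * M)) (shift e M Y)) ([m+kn]%n≡m%n (e * 2 * Y) e (2 * M))
    where
    shift : ∀ e M Y → e * 2 * (M + Y) ≡ e * 2 * Y + e * (2 * M)
    shift = solve-∀

  nearZeroMultiples-odd : ∀ {w} e → w ≤ M →
    nearZeroMultiples (2 * M) w (1 + e * 2) ≡ nearZeroMultiples M w (1 + e * 2)
  nearZeroMultiples-odd {w} e w≤M = trans (∑-double M _) (∑-cong M (λ {Y} _ → both-halves Y))
    where
    d = 1 + e * 2
    F : ℕ → ℕ
    F x = nearZeroCount (2 * M) w (x % (2 * M))
    both-halves : ∀ Y → F (d * Y) + F (d * (M + Y)) ≡ nearZeroCount M w ((d * Y) % M)
    both-halves Y = trans (cong (F (d * Y) +_) (cong (nearZeroCount (2 * M) w) (%-odd-shift e Y)))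
                          (nearZeroCount-pair (d * Y) w≤M)

  nearZeroMultiples-even : ∀ {w} e → nearZeroMultiples (2 * M) (2 * w) (e * 2) ≡ 2 * nearZeroMultiples M w e
  nearZeroMultiples-even {w} e = begin
    nearZeroMultiples (2 * M) (2 * w) (e * 2)                   ≡⟨ ∑-double M _ ⟩
    ∑[ Y < M ] (F (e * 2 * Y) + F (e * 2 * (M + Y)))            ≡⟨ ∑-cong M (λ {Y} _ → both-halves Y) ⟩
    ∑[ Y < M ] (2 * nearZeroCount M w ((e * Y) % M))            ≡⟨ ∑-distribˡ-* M 2 _ ⟩
    2 * nearZeroMultiples M w e                                 ∎
    where
    open ≡-Reasoning
    F : ℕ → ℕ
    F x = nearZeroCount (2 * M) (2 * w) (x % (2 * M))
    both-halves : ∀ Y → F (e * 2 * Y) + F (e * 2 * (M + Y)) ≡ 2 * nearZeroCount M w ((e * Y) % M)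
    both-halves Y = begin
      F (e * 2 * Y) + F (e * 2 * (M + Y))  ≡⟨ cong (F (e * 2 * Y) +_) (cong (nearZeroCount (2 * M) (2 * w)) (%-even-shift e Y)) ⟩
      F (e * 2 * Y) + F (e * 2 * Y)        ≡⟨ 2*m≡m+m (F (e * 2 * Y)) ⟨
      2 * F (e * 2 * Y)                    ≡⟨ cong (2 *_) (nearZeroCount-even {w = w} e Y) ⟩
      2 * nearZeroCount M w ((e * Y) % M)  ∎

-- For odd d the residues of dY and d(M + Y) modulo 2M are the two lifts of dY modulo M,
-- so halving the modulus keeps the count; for even d, the multiplier, the modulus and
-- the width all halve.
nearZeroMultiples≤ : ∀ {M} .{{_ : NonZero M}} a b d → M ≡ 2 ^ a → b ≤ a → 0 < d → d < 2 ^ b →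
  nearZeroMultiples M (2 ^ b) d ≤ 2 * 2 ^ b
nearZeroMultiples≤ {M} a b d M≡2^a b≤a 0<d d<2^b with m≤n⇒m<n∨m≡n b≤a
... | inj₂ refl = begin
  nearZeroMultiples M (2 ^ b) d     ≤⟨ ∑-mono-≤ M (λ {Y} _ → nearZeroCount≤2 M (2 ^ b) ((d * Y) % M)) ⟩
  ∑[ _ < M ] 2                      ≡⟨ ∑-const M 2 ⟩
  M * 2                             ≡⟨ *-comm M 2 ⟩
  2 * M                             ≡⟨ cong (2 *_) M≡2^a ⟩
  2 * 2 ^ b                         ∎
  where open ≤-Reasoning
nearZeroMultiples≤ (suc a) b d refl _ 0<d d<2^b | inj₁ (s≤s b≤a) with evenOdd d
... | odd e = begin
  nearZeroMultiples (2 * 2 ^ a) (2 ^ b) (1 + e * 2) ≡⟨ nearZeroMultiples-odd {2 ^ a} e (^-monoʳ-≤ 2 b≤a) ⟩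
  nearZeroMultiples (2 ^ a) (2 ^ b) (1 + e * 2)     ≤⟨ nearZeroMultiples≤ a b (1 + e * 2) refl b≤a 0<d d<2^b ⟩
  2 * 2 ^ b                                        ∎
  where
  open ≤-Reasoning
  instance _ = m^n≢0 2 a
nearZeroMultiples≤ (suc a) zero _ refl _ 0<d d<1 | inj₁ _ | even e = contradiction (≤-trans 0<d (s≤s⁻¹ d<1)) λ ()
nearZeroMultiples≤ (suc a) (suc b) _ refl _ 0<d d<2^b | inj₁ (s≤s b<a) | even e = begin
  nearZeroMultiples (2 * 2 ^ a) (2 * 2 ^ b) (e * 2) ≡⟨ nearZeroMultiples-even {2 ^ a} e ⟩
  2 * nearZeroMultiples (2 ^ a) (2 ^ b) e            ≤⟨ *-monoʳ-≤ 2 (nearZeroMultiples≤ a b e refl (<⇒≤ b<a) 0<e e<2^b) ⟩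
  2 * (2 * 2 ^ b)                                ∎
  where
  open ≤-Reasoning
  instance _ = m^n≢0 2 a
  0<e : 0 < e
  0<e = *-cancelʳ-< 2 0 e 0<d
  e<2^b : e < 2 ^ b
  e<2^b = *-cancelʳ-< 2 e (2 ^ b) (subst (e * 2 <_) (*-comm 2 (2 ^ b)) d<2^b)

-- Density of retrorse blocks

-- Union bound: a Y that is not spread is near zero for some multiplier j + 1 ≤ w/4, and
-- each multiplier has at most 2w near-zero multiples, so at most w²/2 residues fail.
spread-density : ∀ {w} .{{_ : NonZero w}} b → w ≡ 2 ^ b → {P : ℕ → Set} (P? : Decidable P) →
  (∀ Y → Spread w Y → P Y) → w * w ≤ 2 * ∑[ Y < w * w ] 𝟙 (P? Y)
spread-density {w} b refl {P} P? spread⇒P = +-cancelʳ-≤ M M (2 * #P) (begin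
  M + M                                  ≡⟨ 2*m≡m+m M ⟨
  2 * M                                  ≤⟨ *-monoʳ-≤ 2 M≤#P+#bad ⟩
  2 * (#P + #bad)                        ≡⟨ *-distribˡ-+ 2 #P #bad ⟩
  2 * #P + 2 * #bad                      ≤⟨ +-monoʳ-≤ (2 * #P) 2#bad≤M ⟩
  2 * #P + M                             ∎)
  where
  open ≤-Reasoning
  M = w * w
  instance _ = m*n≢0 w w
  #P = ∑[ Y < M ] 𝟙 (P? Y)
  bad : ℕ → ℕ → ℕ
  bad Y j = nearZeroCount M w ((suc j * Y) % M)
  #bad = ∑[ Y < M ] ∑[ j < w / 4 ] bad Y j
  spread-or-bad : ∀ Y → 1 ≤ 𝟙 (P? Y) + ∑[ j < w / 4 ] bad Y j
  spread-or-bad Y with P? Y | ∑[ j < w / 4 ] bad Y j in ∑bad≡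
  ... | yes _ | _ = s≤s z≤n
  ... | no _ | suc _ = s≤s z≤n
  ... | no ¬PY | zero = contradiction (spread⇒P Y spread) ¬PY
    where
    spread : Spread w Y
    spread zero () _
    spread (suc j) _ 4d<w = nearZeroCount≡0⇒¬NearZero M w _ (∑≡0⇒≡0 (w / 4) (bad Y) ∑bad≡ j<w/4)
      where
      j<w/4 : j < w / 4
      j<w/4 = subst (_≤ w / 4) (m*n/n≡m (suc j) 4) (/-monoˡ-≤ 4 (subst (_≤ w) (*-comm 4 (suc j)) (<⇒≤ 4d<w)))
  M≤#P+#bad : M ≤ #P + #bad
  M≤#P+#bad = begin
    M                                              ≡⟨ trans (∑-const M 1) (*-identityʳ M) ⟨
    ∑[ _ < M ] 1                                   ≤⟨ ∑-mono-≤ M (λ {Y} _ → spread-or-bad Y) ⟩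
    ∑[ Y < M ] (𝟙 (P? Y) + ∑[ j < w / 4 ] bad Y j) ≡⟨ ∑-distrib-+ M _ _ ⟩
    #P + #bad                                      ∎
  2#bad≤M : 2 * #bad ≤ M
  2#bad≤M = begin
    2 * #bad                                       ≡⟨ cong (2 *_) (∑-comm M (w / 4) bad) ⟩
    2 * ∑[ j < w / 4 ] nearZeroMultiples M w (suc j) ≤⟨ *-monoʳ-≤ 2 (∑-mono-≤ (w / 4) per-multiplier) ⟩
    2 * ∑[ _ < w / 4 ] (2 * w)                     ≡⟨ cong (2 *_) (∑-const (w / 4) (2 * w)) ⟩
    2 * (w / 4 * (2 * w))                          ≡⟨ regroup (w / 4) w ⟩
    w / 4 * 4 * w                                  ≤⟨ *-monoˡ-≤ w (m/n*n≤m w 4) ⟩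
    M                                              ∎
    where
    regroup : ∀ v w → 2 * (v * (2 * w)) ≡ v * 4 * w
    regroup = solve-∀
    per-multiplier : ∀ {j} → j < w / 4 → nearZeroMultiples M w (suc j) ≤ 2 * w
    per-multiplier j<w/4 = nearZeroMultiples≤ (b + b) b _ (sym (^-distribˡ-+-* 2 b b)) (m≤m+n b b) (s≤s z≤n)
      (≤-<-trans j<w/4 (m/n<m w 4 (s≤s (s≤s z≤n))))

-- Opaque so that conversion checking never tries to evaluate the decision procedure
-- retrorse?, which is extremely slow.
opaque
  isRetrorse : (q : ℕ) .{{_ : NonZero q}} (n ℓ Y′ : ℕ) → ℕ
  isRetrorse q n ℓ Y′ = 𝟙 (retrorse? q n ℓ Y′)

opaque
  unfolding isRetrorse

  I≡ℓ*isRetrorse : ∀ q .{{_ : NonZero q}} n Y ℓ → I q n Y ℓ ≡ ℓ * isRetrorse q n ℓ (block q 0 (2 * ℓ) Y)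
  I≡ℓ*isRetrorse q n Y ℓ = if-does≡*𝟙 R? ℓ
    where
    R? : Dec (Retrorse q n ℓ (block q 0 (2 * ℓ) Y))
    R? = retrorse? q n ℓ (block q 0 (2 * ℓ) Y)

  spread⇒isRetrorse≡1 : ∀ q .{{_ : NonZero q}} n ℓ Y′ →
    Spread (q ^ ℓ) {{m^n≢0 q ℓ}} Y′ → isRetrorse q n ℓ Y′ ≡ 1
  spread⇒isRetrorse≡1 q n ℓ Y′ spread = 𝟙-yes R? (spread⇒retrorse q n ℓ Y′ spread)
    where
    R? : Dec (Retrorse q n ℓ Y′)
    R? = retrorse? q n ℓ Y′

  retrorse-density : ∀ q .{{_ : NonZero q}} → IsPow2 q → ∀ n ℓ →
    q ^ (2 * ℓ) ≤ 2 * ∑[ Y′ < q ^ (2 * ℓ) ] isRetrorse q n ℓ Y′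
  retrorse-density q (δ , refl) n ℓ = subst (λ M → M ≤ 2 * ∑[ Y′ < M ] 𝟙 (R? Y′)) (sym (^-double q ℓ))
    (spread-density {w = q ^ ℓ} {{m^n≢0 q ℓ}} (δ * ℓ) (^-*-assoc 2 δ ℓ) R? (spread⇒retrorse q n ℓ))
    where
    R? : Decidable (Retrorse q n ℓ)
    R? = retrorse? q n ℓ

^-∸-split : ∀ q {m n} → m ≤ n → q ^ n ≡ q ^ (n ∸ m) * q ^ m
^-∸-split q {m} {n} m≤n = trans (cong (q ^_) (sym (m∸n+n≡m m≤n))) (^-distribˡ-+-* q (n ∸ m) m)

sumI-periodic : ∀ q .{{_ : NonZero q}} n ℓ → 2 * ℓ ≤ n →
  sumI q n ℓ ≡ q ^ (n ∸ 2 * ℓ) * (ℓ * ∑[ Y′ < q ^ (2 * ℓ) ] isRetrorse q n ℓ Y′)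
sumI-periodic q n ℓ 2ℓ≤n = begin
  sumI q n ℓ                                   ≡⟨ sum-map-upTo (q ^ n) I′ ⟩
  ∑[ Y < q ^ n ] I′ Y                          ≡⟨ ∑-cong (q ^ n) (λ {Y} _ → I′≡ Y) ⟩
  ∑[ Y < q ^ n ] R (Y mod)                     ≡⟨ cong (λ N → ∑[ Y < N ] R (Y mod)) (^-∸-split q 2ℓ≤n) ⟩
  ∑[ Y < c * q ^ (2 * ℓ) ] R (Y mod)           ≡⟨ ∑-periodic c (q ^ (2 * ℓ)) {{m^n≢0 q (2 * ℓ)}} R ⟩
  c * ∑[ Y′ < q ^ (2 * ℓ) ] R Y′               ≡⟨ cong (c *_) (∑-distribˡ-* (q ^ (2 * ℓ)) ℓ (isRetrorse q n ℓ)) ⟩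
  c * (ℓ * ∑[ Y′ < q ^ (2 * ℓ) ] isRetrorse q n ℓ Y′) ∎
  where
  open ≡-Reasoning
  c = q ^ (n ∸ 2 * ℓ)
  I′ : ℕ → ℕ
  I′ Y = I q n Y ℓ
  _mod : ℕ → ℕ
  Y mod = _%_ Y (q ^ (2 * ℓ)) {{m^n≢0 q (2 * ℓ)}}
  R : ℕ → ℕ
  R Y′ = ℓ * isRetrorse q n ℓ Y′
  I′≡ : ∀ Y → I′ Y ≡ R (Y mod)
  I′≡ Y = trans (I≡ℓ*isRetrorse q n Y ℓ) (cong (R ∘ _mod) (n/1≡n Y))

sumI-lower-bound : ∀ q .{{_ : NonZero q}} → IsPow2 q → ∀ n ℓ → 2 * ℓ ≤ n → ℓ * q ^ n ≤ 2 * sumI q n ℓ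
sumI-lower-bound q q-pow2 n ℓ 2ℓ≤n = begin
  ℓ * q ^ n                   ≡⟨ cong (ℓ *_) (^-∸-split q 2ℓ≤n) ⟩
  ℓ * (c * q ^ (2 * ℓ))       ≤⟨ *-monoʳ-≤ ℓ (*-monoʳ-≤ c (retrorse-density q q-pow2 n ℓ)) ⟩
  ℓ * (c * (2 * #retrorse))   ≡⟨ regroup ℓ c #retrorse ⟩
  2 * (c * (ℓ * #retrorse))   ≡⟨ cong (2 *_) {x = sumI q n ℓ} (sumI-periodic q n ℓ 2ℓ≤n) ⟨
  2 * sumI q n ℓ              ∎
  where
  open ≤-Reasoning
  c = q ^ (n ∸ 2 * ℓ)
  #retrorse = ∑[ Y′ < q ^ (2 * ℓ) ] isRetrorse q n ℓ Y′
  regroup : ∀ ℓ c r → ℓ * (c * (2 * r)) ≡ 2 * (c * (ℓ * r))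
  regroup = solve-∀

-- The low digits of K

n<2^n : ∀ n → n < 2 ^ n
n<2^n zero = s≤s z≤n
n<2^n (suc n) = subst (_≤ 2 ^ suc n) (+-comm (suc n) 1) (+-mono-≤ (n<2^n n) (≤-trans (m^n>0 2 n) (m≤m+n (2 ^ n) 0)))

isPow2ᵇ-complete : ∀ c → T (isPow2ᵇ (2 ^ c))
isPow2ᵇ-complete c = any⁺ _ (lose (∈-upTo⁺ (s≤s (<⇒≤ (n<2^n c)))) (≡⇒≡ᵇ (2 ^ c) (2 ^ c) refl))

isPow2ᵇ-sound : ∀ m → T (isPow2ᵇ m) → IsPow2 m
isPow2ᵇ-sound m isPow with satisfied (any⁻ _ (upTo (suc m)) isPow)
... | k , 2^k≡ᵇm = k , sym (≡ᵇ⇒≡ (2 ^ k) m 2^k≡ᵇm)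

¬IsPow2-between : ∀ c {m} → 2 ^ c < m → m < 2 ^ suc c → ¬ IsPow2 m
¬IsPow2-between c 2^c<m m<2^c+1 (k , refl) with k ≤? c
... | yes k≤c = <⇒≱ 2^c<m (^-monoʳ-≤ 2 k≤c)
... | no k≰c = <⇒≱ m<2^c+1 (^-monoʳ-≤ 2 (≰⇒> k≰c))

pow2Bit : ℕ → ℕ
pow2Bit i = if isPow2ᵇ i then 2 ^ i else 0

pow2Bit≤ : ∀ i → pow2Bit i ≤ 2 ^ i
pow2Bit≤ i with isPow2ᵇ i
... | true = ≤-refl
... | false = z≤n

pow2Bit-2^ : ∀ c → pow2Bit (2 ^ c) ≡ 2 ^ 2 ^ c
pow2Bit-2^ c with isPow2ᵇ (2 ^ c) | isPow2ᵇ-complete c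
... | true | _ = refl

pow2Bit-¬IsPow2 : ∀ i → ¬ IsPow2 i → pow2Bit i ≡ 0
pow2Bit-¬IsPow2 i ¬pow with isPow2ᵇ i in isPow
... | false = refl
... | true = contradiction (isPow2ᵇ-sound i (subst T (sym isPow) _)) ¬pow

pow2Bit-+ : ∀ m i → pow2Bit (m + i) ≡ 2 ^ m * (if isPow2ᵇ (m + i) then 2 ^ i else 0)
pow2Bit-+ m i with isPow2ᵇ (m + i)
... | true = ^-distribˡ-+-* 2 m i
... | false = sym (*-zeroʳ (2 ^ m))

∑pow2Bit-after-2^ : ∀ c m → 0 < m → m ≤ 2 ^ c → ∑[ i < m ] pow2Bit (2 ^ c + i) ≡ 2 ^ 2 ^ c
∑pow2Bit-after-2^ c (suc zero) _ _ = trans (cong pow2Bit (+-identityʳ (2 ^ c))) (pow2Bit-2^ c)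
∑pow2Bit-after-2^ c (suc (suc m)) _ m+2≤2^c = begin
  ∑[ i < suc m ] pow2Bit (2 ^ c + i) + pow2Bit (2 ^ c + suc m)
    ≡⟨ cong (∑[ i < suc m ] pow2Bit (2 ^ c + i) +_) (pow2Bit-¬IsPow2 _ (¬IsPow2-between c 2^c<2^c+m+1 2^c+m+1<2^c+1)) ⟩
  ∑[ i < suc m ] pow2Bit (2 ^ c + i) + 0
    ≡⟨ +-identityʳ _ ⟩
  ∑[ i < suc m ] pow2Bit (2 ^ c + i)
    ≡⟨ ∑pow2Bit-after-2^ c (suc m) (s≤s z≤n) (<⇒≤ m+2≤2^c) ⟩
  2 ^ 2 ^ c
    ∎
  where
  open ≡-Reasoning
  2^c<2^c+m+1 : 2 ^ c < 2 ^ c + suc m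
  2^c<2^c+m+1 = m<m+n (2 ^ c) (s≤s z≤n)
  2^c+m+1<2^c+1 : 2 ^ c + suc m < 2 ^ suc c
  2^c+m+1<2^c+1 = subst (2 ^ c + suc m <_) (cong (2 ^ c +_) (sym (+-identityʳ (2 ^ c)))) (+-monoʳ-< (2 ^ c) m+2≤2^c)

∑pow2Bit-mod : ∀ m r → _%_ (∑[ i < m + r ] pow2Bit i) (2 ^ m) {{m^n≢0 2 m}} ≡ ∑[ i < m ] pow2Bit i
∑pow2Bit-mod m r = %-unique high (∑<2^ m pow2Bit pow2Bit≤) (begin
  ∑[ i < m + r ] pow2Bit i                           ≡⟨ ∑-+ m r pow2Bit ⟩
  ∑[ i < m ] pow2Bit i + ∑[ i < r ] pow2Bit (m + i)  ≡⟨ cong (∑[ i < m ] pow2Bit i +_) factor ⟩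
  ∑[ i < m ] pow2Bit i + high * 2 ^ m                ∎)
  where
  open ≡-Reasoning
  instance _ = m^n≢0 2 m
  high = ∑[ i < r ] (if isPow2ᵇ (m + i) then 2 ^ i else 0)
  factor : ∑[ i < r ] pow2Bit (m + i) ≡ high * 2 ^ m
  factor = trans (∑-cong r (λ {i} _ → pow2Bit-+ m i)) (trans (∑-distribˡ-* r (2 ^ m) _) (*-comm (2 ^ m) high))

∑pow2Bit-mod-2^ : ∀ c m → 2 ^ c + 2 ^ c ≤ m →
  _%_ (∑[ i < m ] pow2Bit i) (2 ^ (2 ^ c + 2 ^ c)) {{m^n≢0 2 (2 ^ c + 2 ^ c)}} ≡ 2 ^ 2 ^ c + ∑[ i < 2 ^ c ] pow2Bit i
∑pow2Bit-mod-2^ c m 2E≤m = begin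
  (∑[ i < m ] pow2Bit i) % 2 ^ (E + E)
    ≡⟨ cong (λ n → (∑[ i < n ] pow2Bit i) % 2 ^ (E + E)) (m+[n∸m]≡n 2E≤m) ⟨
  (∑[ i < E + E + (m ∸ (E + E)) ] pow2Bit i) % 2 ^ (E + E)
    ≡⟨ ∑pow2Bit-mod (E + E) (m ∸ (E + E)) ⟩
  ∑[ i < E + E ] pow2Bit i
    ≡⟨ ∑-+ E E pow2Bit ⟩
  ∑[ i < E ] pow2Bit i + ∑[ i < E ] pow2Bit (E + i)
    ≡⟨ cong (∑[ i < E ] pow2Bit i +_) (∑pow2Bit-after-2^ c E (m^n>0 2 c) ≤-refl) ⟩
  ∑[ i < E ] pow2Bit i + 2 ^ E
    ≡⟨ +-comm _ (2 ^ E) ⟩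
  2 ^ E + ∑[ i < E ] pow2Bit i
    ∎
  where
  open ≡-Reasoning
  E = 2 ^ c
  instance _ = m^n≢0 2 (E + E)

K-mod-2^[E+E] : ∀ δ n c → 2 ^ c + 2 ^ c ≤ δ * n →
  _%_ (K δ n) (2 ^ (2 ^ c + 2 ^ c)) {{m^n≢0 2 (2 ^ c + 2 ^ c)}} ≡ 2 ^ 2 ^ c + ∑[ i < 2 ^ c ] pow2Bit i
K-mod-2^[E+E] δ n c E+E≤δn =
  trans (cong (λ x → _%_ x (2 ^ (2 ^ c + 2 ^ c)) {{m^n≢0 2 (2 ^ c + 2 ^ c)}}) (sum-map-upTo (δ * n) pow2Bit))
        (∑pow2Bit-mod-2^ c (δ * n) E+E≤δn)

w+u-spread : ∀ {w} .{{_ : NonZero w}} {u} → u < w → Spread w (w + u)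
w+u-spread {w} {u} u<w d 0<d 4d<w near =
  [ (λ v<w → <⇒≱ v<w w≤v) , (λ M<v+w → <⇒≱ M<v+w v+w≤M) ] (subst (NearZero (w * w) w) (m<n⇒m%n≡m v<M) near)
  where
  instance _ = m*n≢0 w w
  v = d * (w + u)
  w≤v : w ≤ v
  w≤v = begin
    w            ≤⟨ m≤m+n w u ⟩
    w + u        ≡⟨ *-identityˡ (w + u) ⟨
    1 * (w + u)  ≤⟨ *-monoˡ-≤ (w + u) 0<d ⟩
    v            ∎
    where open ≤-Reasoning
  v+w≤M : v + w ≤ w * w
  v+w≤M = begin
    d * (w + u) + w   ≤⟨ +-monoˡ-≤ w (*-monoʳ-≤ d (+-monoʳ-≤ w (<⇒≤ u<w))) ⟩
    d * (w + w) + w   ≡⟨ regroup d w ⟩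
    (2 * d + 1) * w   ≤⟨ *-monoˡ-≤ w 2d+1≤w ⟩
    w * w             ∎
    where
    open ≤-Reasoning
    regroup : ∀ d w → d * (w + w) + w ≡ (2 * d + 1) * w
    regroup = solve-∀
    2d+1≤w : 2 * d + 1 ≤ w
    2d+1≤w = ≤-trans (+-monoˡ-≤ 1 (*-monoˡ-≤ d (s≤s (s≤s (z≤n {2}))))) (subst (_≤ w) (+-comm 1 (4 * d)) 4d<w)
  v<M : v < w * w
  v<M = <-≤-trans (m<m+n v (>-nonZero⁻¹ w)) v+w≤M

spread⇒I≡ℓ : ∀ q .{{_ : NonZero q}} n ℓ Y → Spread (q ^ ℓ) {{m^n≢0 q ℓ}} (block q 0 (2 * ℓ) Y) → I q n Y ℓ ≡ ℓ
spread⇒I≡ℓ q n ℓ Y spread = begin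
  I q n Y ℓ                                     ≡⟨ I≡ℓ*isRetrorse q n Y ℓ ⟩
  ℓ * isRetrorse q n ℓ (block q 0 (2 * ℓ) Y)    ≡⟨ cong (ℓ *_) (spread⇒isRetrorse≡1 q n ℓ _ spread) ⟩
  ℓ * 1                                         ≡⟨ *-identityʳ ℓ ⟩
  ℓ                                             ∎
  where open ≡-Reasoning

K-low-digit-split : ∀ δ n ℓ → IsPow2 (δ * ℓ) → 2 * ℓ ≤ n →
  ∃ λ u → u < (2 ^ δ) ^ ℓ × block (2 ^ δ) {{m^n≢0 2 δ}} 0 (2 * ℓ) (K δ n) ≡ (2 ^ δ) ^ ℓ + u
K-low-digit-split δ n ℓ (c , δℓ≡E) 2ℓ≤n = u , subst (u <_) (sym q^ℓ≡2^E) (∑<2^ E pow2Bit pow2Bit≤) , (begin-equality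
  (K δ n / 1) % q ^ (2 * ℓ)                      ≡⟨ cong (_% q ^ (2 * ℓ)) (n/1≡n (K δ n)) ⟩
  K δ n % q ^ (2 * ℓ)                            ≡⟨ %-congʳ {{_}} {{m^n≢0 2 (E + E)}} q^2ℓ≡2^[E+E] ⟩
  _%_ (K δ n) (2 ^ (E + E)) {{m^n≢0 2 (E + E)}}  ≡⟨ K-mod-2^[E+E] δ n c E+E≤δn ⟩
  2 ^ E + u                                      ≡⟨ cong (_+ u) q^ℓ≡2^E ⟨
  q ^ ℓ + u                                      ∎)
  where
  open ≤-Reasoning
  q = 2 ^ δ
  E = 2 ^ c
  u = ∑[ i < E ] pow2Bit i
  instance
    _ = m^n≢0 2 δ
    _ = m^n≢0 q (2 * ℓ)
  q^ℓ≡2^E : q ^ ℓ ≡ 2 ^ E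
  q^ℓ≡2^E = trans (^-*-assoc 2 δ ℓ) (cong (2 ^_) δℓ≡E)
  q^2ℓ≡2^[E+E] : q ^ (2 * ℓ) ≡ 2 ^ (E + E)
  q^2ℓ≡2^[E+E] = trans (^-double q ℓ) (trans (cong₂ _*_ q^ℓ≡2^E q^ℓ≡2^E) (sym (^-distribˡ-+-* 2 E E)))
  E+E≤δn : E + E ≤ δ * n
  E+E≤δn = begin
    E + E            ≡⟨ cong₂ _+_ δℓ≡E δℓ≡E ⟨
    δ * ℓ + δ * ℓ    ≡⟨ 2*m≡m+m (δ * ℓ) ⟨
    2 * (δ * ℓ)      ≡⟨ x∙yz≈y∙xz 2 δ ℓ ⟩
    δ * (2 * ℓ)      ≤⟨ *-monoʳ-≤ δ 2ℓ≤n ⟩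
    δ * n            ∎

I-K≡ℓ : ∀ δ n ℓ → IsPow2 (δ * ℓ) → 2 * ℓ ≤ n → I (2 ^ δ) {{m^n≢0 2 δ}} n (K δ n) ℓ ≡ ℓ
I-K≡ℓ δ n ℓ δℓ-pow2 2ℓ≤n =
  let u , u<q^ℓ , low≡q^ℓ+u = K-low-digit-split δ n ℓ δℓ-pow2 2ℓ≤n in
  spread⇒I≡ℓ (2 ^ δ) {{q≢0}} n ℓ (K δ n)
    (subst (Spread ((2 ^ δ) ^ ℓ) {{q^ℓ≢0}}) (sym low≡q^ℓ+u) (w+u-spread {{q^ℓ≢0}} u<q^ℓ))
  where
  q≢0 = m^n≢0 2 δ
  q^ℓ≢0 = m^n≢0 (2 ^ δ) ℓ {{q≢0}}

IsPow2-* : ∀ {m n} → IsPow2 m → IsPow2 n → IsPow2 (m * n)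
IsPow2-* (a , refl) (b , refl) = a + b , sym (^-distribˡ-+-* 2 a b)

lemma11 : (n δ ℓ : ℕ) → IsPow2 n → IsPow2 δ → IsPow2 ℓ → 2 * ℓ ≤ n →
    (ℓ * (2 ^ δ) ^ n ≤ 2 * sumI (2 ^ δ) {{m^n≢0 2 δ}} n ℓ)
    × (I (2 ^ δ) {{m^n≢0 2 δ}} n (K δ n) ℓ ≡ ℓ)
lemma11 n δ ℓ _ δ-pow2 ℓ-pow2 2ℓ≤n =
  sumI-lower-bound (2 ^ δ) {{m^n≢0 2 δ}} (δ , refl) n ℓ 2ℓ≤n ,
  I-K≡ℓ δ n ℓ (IsPow2-* δ-pow2 ℓ-pow2) 2ℓ≤n
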